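{- Let $\mathbf{A}=\langle A,\lor,\land,\to,\neg,\sim,0,1\rangle$ be a finite Heyting algebra with involution. Then there is a one-to-one correspondence between the set of all involutive filters of $\mathbf{A}$ and the set of all filters of the Boolean algebra $\langle IC(A),\lor,\land,\to,\neg,0,1\rangle$.
   Context: A Heyting algebra with involution is an algebra $\langle A,\lor,\land,\to,\neg,\sim,0,1\rangle$ where $\langle A,\lor,\land,\to,\neg,0,1\rangle$ is a Heyting algebra ($a\to b=\sup\{x:a\land x\le b\}$, $\neg a=a\to 0$) and $\sim$ satisfies $\sim(a\lor b)=\sim a\land\sim b$ and $\sim\sim a=a$. A filter is a lattice filter; a filter $F$ of $\mathbf{A}$ is involutive if $a\in F$ implies $\neg\sim a\in F$. The involutive center is $IC(A)=\{a\in A:\neg a=\sim a\}$; with the operations inherited from $\mathbf{A}$ it is a Boolean algebra. -}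

module Defs where

open import Level using (Level; _⊔_; suc)
open import Data.Nat using (ℕ)
open import Data.Fin using (Fin)
open import Data.Product using (Σ; ∃; _×_; _,_; proj₁)
open import Function.Bundles using (Bijection; _⇔_)
open import Relation.Binary.Bundles using (Setoid)
open import Relation.Binary.Lattice.Bundles using (HeytingAlgebra)
import Relation.Binary.PropositionalEquality as ≡
import Function.Properties.Equivalence

record HeytingAlgebraWithInvolution c ℓ₁ ℓ₂ : Set (suc (c ⊔ ℓ₁ ⊔ ℓ₂)) where
  field
    heyting : HeytingAlgebra c ℓ₁ ℓ₂
  open HeytingAlgebra heyting public
  field
    ∼_     : Carrier → Carrier
    ∼-cong : ∀ {a b} → a ≈ b → (∼ a) ≈ (∼ b)
    ∼-∨    : ∀ a b → (∼ (a ∨ b)) ≈ ((∼ a) ∧ (∼ b))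
    ∼∼     : ∀ a → (∼ (∼ a)) ≈ a

  ¬_ : Carrier → Carrier
  ¬ a = a ⇨ ⊥

module _ {c ℓ₁ ℓ₂ : Level} (A : HeytingAlgebraWithInvolution c ℓ₁ ℓ₂) where
  open HeytingAlgebraWithInvolution A

  IsFinite : Set (c ⊔ ℓ₁)
  IsFinite = ∃ λ (n : ℕ) → Bijection (≡.setoid (Fin n)) setoid

  record IsFilter {p : Level} (F : Carrier → Set p) : Set (c ⊔ ℓ₂ ⊔ p) where
    field
      nonempty : ∃ λ a → F a
      upward   : ∀ {a b} → a ≤ b → F a → F b
      meet     : ∀ {a b} → F a → F b → F (a ∧ b)

  record IsInvolutiveFilter {p : Level} (F : Carrier → Set p) : Set (c ⊔ ℓ₂ ⊔ p) where
    field
      isFilter   : IsFilter F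
      involutive : ∀ {a} → F a → F (¬ (∼ a))

  IC : Set (c ⊔ ℓ₁)
  IC = Σ Carrier λ a → (¬ a) ≈ (∼ a)

  -- Lattice filter of the Boolean algebra IC(A), whose order and meet are
  -- inherited from A (IC(A) is a sub-Boolean-algebra of A).
  record IsICFilter {p : Level} (G : IC → Set p) : Set (c ⊔ ℓ₁ ⊔ ℓ₂ ⊔ p) where
    field
      nonempty : ∃ λ x → G x
      upward   : ∀ {x y : IC} → proj₁ x ≤ proj₁ y → G x → G y
      meet     : ∀ {x y z : IC} → proj₁ z ≈ (proj₁ x ∧ proj₁ y) → G x → G y → G z

  -- Subsets are predicates valued in Set (c ⊔ ℓ₁ ⊔ ℓ₂ ⊔ p), large enough that
  -- e.g. upward closures {a : ∃ x ∈ G, x ≤ a} stay at the same level.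
  InvolutiveFilters : (p : Level) → Setoid (suc (c ⊔ ℓ₁ ⊔ ℓ₂ ⊔ p)) (c ⊔ ℓ₁ ⊔ ℓ₂ ⊔ p)
  InvolutiveFilters p = record
    { Carrier = Σ (Carrier → Set (c ⊔ ℓ₁ ⊔ ℓ₂ ⊔ p)) IsInvolutiveFilter
    ; _≈_ = λ F G → ∀ a → proj₁ F a ⇔ proj₁ G a
    ; isEquivalence = record
      { refl = λ a → Function.Properties.Equivalence.refl
      ; sym = λ eq a → Function.Properties.Equivalence.sym (eq a)
      ; trans = λ e1 e2 a → Function.Properties.Equivalence.trans (e1 a) (e2 a) } }

  ICFilters : (p : Level) → Setoid (suc (c ⊔ ℓ₁ ⊔ ℓ₂ ⊔ p)) (c ⊔ ℓ₁ ⊔ ℓ₂ ⊔ p)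
  ICFilters p = record
    { Carrier = Σ (IC → Set (c ⊔ ℓ₁ ⊔ ℓ₂ ⊔ p)) IsICFilter
    ; _≈_ = λ F G → ∀ x → proj₁ F x ⇔ proj₁ G x
    ; isEquivalence = record
      { refl = λ a → Function.Properties.Equivalence.refl
      ; sym = λ eq a → Function.Properties.Equivalence.sym (eq a)
      ; trans = λ e1 e2 a → Function.Properties.Equivalence.trans (e1 a) (e2 a) } }

-- For a ∈ F the sequence a, ν a, ν (ν a), … with ν x = x ∧ ¬∼x stays in the
-- involutive filter F and decreases, so in a finite algebra it reaches some x
-- with x ≤ ¬∼x, i.e. x ∧ ∼x = 0, and that is exactly the condition x ∈ IC(A).
-- Hence every involutive filter is the upset of its trace on IC(A), so
-- F ↦ F ∩ IC(A) is a bijection with inverse G ↦ ↑G; the upset of a filter of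
-- IC(A) is involutive because ∼x = ¬x on IC(A).
module Submission where

open import Defs
open import Level using (Level; _⊔_)
open import Function.Base using (_∘_)
open import Function.Bundles using (Bijection; Inverse; mk⇔; Equivalence)
open import Function.Definitions using (Congruent; Injective; Surjective)
open import Function.Properties.Bijection using (Bijection⇒Inverse)
open import Function.Properties.Equivalence using () renaming (trans to ⇔-trans)
open import Data.Product using (Σ; ∃; ∃₂; _×_; _,_; proj₁; proj₂)
open import Data.Nat as ℕ using (ℕ; zero; suc)
open import Data.Nat.Properties using (n<1+n; ≤⇒≤′; z≤′n)
open import Data.Nat.GeneralisedArithmetic using (fold)
open import Data.Fin using (Fin; toℕ)
open import Data.Fin.Properties using (pigeonhole)
open import Relation.Binary.Bundles using (Setoid; Poset)
import Relation.Binary.PropositionalEquality as ≡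

module _ {c ℓ} (S : Setoid c ℓ) {n} (bij : Bijection (≡.setoid (Fin n)) S) where
  open Setoid S
  open Inverse (Bijection⇒Inverse bij)

  finite⇒repeats : (s : ℕ → Carrier) → ∃₂ λ i j → i ℕ.< j × s i ≈ s j
  finite⇒repeats s
    with i , j , i<j , same-code ← pigeonhole (n<1+n n) (from ∘ s ∘ toℕ)
    = toℕ i , toℕ j , i<j
    , trans (sym (strictlyInverseˡ _)) (trans (to-cong same-code) (strictlyInverseˡ _))

module _ {c ℓ₁ ℓ₂} (P : Poset c ℓ₁ ℓ₂) where
  open Poset P

  module _ (f : Carrier → Carrier) (deflationary : ∀ x → f x ≤ x) where

    fold-antitone : ∀ a {k m} → k ℕ.≤′ m → fold a f m ≤ fold a f k
    fold-antitone a ℕ.≤′-refl       = refl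
    fold-antitone a (ℕ.≤′-step k≤m) = trans (deflationary _) (fold-antitone a k≤m)

    finite⇒deflationary-stabilises : ∀ {n} → Bijection (≡.setoid (Fin n)) Eq.setoid →
                                      ∀ a → ∃ λ k → fold a f k ≤ f (fold a f k)
    finite⇒deflationary-stabilises bij a
      with i , j , i<j , sᵢ≈sⱼ ← finite⇒repeats Eq.setoid bij (fold a f)
      = i , trans (reflexive sᵢ≈sⱼ) (fold-antitone a (≤⇒≤′ i<j))

module _ {c ℓ₁ ℓ₂ : Level} (A : HeytingAlgebraWithInvolution c ℓ₁ ℓ₂) where
  open HeytingAlgebraWithInvolution A
  open import Relation.Binary.Lattice.Properties.HeytingAlgebra heyting
    using (⇨-eval; ∧-distribˡ-∨-≤)
  open import Relation.Binary.Lattice.Properties.MeetSemilattice meetSemilattice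
    using (∧-monotonic; ∧-comm; ∧-cong)
  open import Relation.Binary.Lattice.Properties.JoinSemilattice joinSemilattice
    using (x≤y⇒x∨y≈y)
  open import Relation.Binary.Reasoning.PartialOrder poset
  module E = Setoid setoid

  ∼-antitone : ∀ {a b} → a ≤ b → ∼ b ≤ ∼ a
  ∼-antitone {a} {b} a≤b = begin
    ∼ b             ≈⟨ ∼-cong (E.sym (x≤y⇒x∨y≈y a≤b)) ⟩
    ∼ (a ∨ b)       ≈⟨ ∼-∨ a b ⟩
    ∼ a ∧ ∼ b       ≤⟨ x∧y≤x _ _ ⟩
    ∼ a             ∎

  ∼x≤y⇒∼y≤x : ∀ {a b} → ∼ a ≤ b → ∼ b ≤ a
  ∼x≤y⇒∼y≤x {a} ∼a≤b = trans (∼-antitone ∼a≤b) (reflexive (∼∼ a))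

  ∼x≤∼y⇒y≤x : ∀ {a b} → ∼ a ≤ ∼ b → b ≤ a
  ∼x≤∼y⇒y≤x {b = b} ∼a≤∼b = trans (reflexive (E.sym (∼∼ b))) (∼x≤y⇒∼y≤x ∼a≤∼b)

  ∼-∧-≤ : ∀ a b → ∼ (a ∧ b) ≤ ∼ a ∨ ∼ b
  ∼-∧-≤ a b = ∼x≤y⇒∼y≤x (begin
    ∼ (∼ a ∨ ∼ b)     ≈⟨ ∼-∨ (∼ a) (∼ b) ⟩
    ∼ ∼ a ∧ ∼ ∼ b     ≈⟨ ∧-cong (∼∼ a) (∼∼ b) ⟩
    a ∧ b             ∎)

  Central : Carrier → Set ℓ₁
  Central a = ¬ a ≈ ∼ a

  central⇒∧∼≤⊥ : ∀ {a} → Central a → a ∧ ∼ a ≤ ⊥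
  central⇒∧∼≤⊥ {a} ¬a≈∼a = begin
    a ∧ ∼ a     ≈⟨ ∧-comm a (∼ a) ⟩
    ∼ a ∧ a     ≈⟨ ∧-cong (E.sym ¬a≈∼a) E.refl ⟩
    ¬ a ∧ a     ≤⟨ ⇨-eval ⟩
    ⊥           ∎

  -- Applying ∼ to a ∧ ∼a ≤ 0 gives a ∨ ∼a = 1, so ∼a is a complement of a and
  -- therefore coincides with the pseudocomplement ¬a.
  ∧∼≤⊥⇒central : ∀ {a} → a ∧ ∼ a ≤ ⊥ → Central a
  ∧∼≤⊥⇒central {a} a∧∼a≤⊥ = antisym ¬a≤∼a ∼a≤¬a
    where
    ∼a≤¬a : ∼ a ≤ ¬ a
    ∼a≤¬a = transpose-⇨ (trans (reflexive (∧-comm (∼ a) a)) a∧∼a≤⊥)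
    ⊤≤a∨∼a : ⊤ ≤ a ∨ ∼ a
    ⊤≤a∨∼a = ∼x≤∼y⇒y≤x (begin
      ∼ (a ∨ ∼ a)     ≈⟨ ∼-∨ a (∼ a) ⟩
      ∼ a ∧ ∼ ∼ a     ≤⟨ ∧-monotonic refl (reflexive (∼∼ a)) ⟩
      ∼ a ∧ a         ≈⟨ ∧-comm (∼ a) a ⟩
      a ∧ ∼ a         ≤⟨ a∧∼a≤⊥ ⟩
      ⊥               ≤⟨ minimum (∼ ⊤) ⟩
      ∼ ⊤             ∎)
    ¬a≤∼a : ¬ a ≤ ∼ a
    ¬a≤∼a = begin
      ¬ a                       ≤⟨ ∧-greatest refl (trans (maximum _) ⊤≤a∨∼a) ⟩
      ¬ a ∧ (a ∨ ∼ a)           ≤⟨ ∧-distribˡ-∨-≤ (¬ a) a (∼ a) ⟩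
      ¬ a ∧ a ∨ ¬ a ∧ ∼ a       ≤⟨ ∨-least (trans ⇨-eval (minimum _)) (x∧y≤y _ _) ⟩
      ∼ a                       ∎

  ⊤-central : Central ⊤
  ⊤-central = ∧∼≤⊥⇒central (trans (x∧y≤y _ _) (∼x≤y⇒∼y≤x (maximum (∼ ⊥))))

  ∧-central : ∀ {a b} → Central a → Central b → Central (a ∧ b)
  ∧-central {a} {b} a-central b-central = ∧∼≤⊥⇒central (begin
    (a ∧ b) ∧ ∼ (a ∧ b)                   ≤⟨ ∧-monotonic refl (∼-∧-≤ a b) ⟩
    (a ∧ b) ∧ (∼ a ∨ ∼ b)                 ≤⟨ ∧-distribˡ-∨-≤ (a ∧ b) (∼ a) (∼ b) ⟩
    (a ∧ b) ∧ ∼ a ∨ (a ∧ b) ∧ ∼ b         ≤⟨ ∨-least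
        (trans (∧-monotonic (x∧y≤x a b) refl) (central⇒∧∼≤⊥ a-central))
        (trans (∧-monotonic (x∧y≤y a b) refl) (central⇒∧∼≤⊥ b-central)) ⟩
    ⊥                                     ∎)

  central-≤⇒≤¬∼ : ∀ {x a} → Central x → x ≤ a → x ≤ ¬ (∼ a)
  central-≤⇒≤¬∼ {x} {a} x-central x≤a = transpose-⇨ (begin
    x ∧ ∼ a      ≤⟨ ∧-monotonic refl (∼-antitone x≤a) ⟩
    x ∧ ∼ x      ≤⟨ central⇒∧∼≤⊥ x-central ⟩
    ⊥            ∎)

  ν : Carrier → Carrier
  ν a = a ∧ ¬ (∼ a)

  ν-deflationary : ∀ x → ν x ≤ x
  ν-deflationary x = x∧y≤x x (¬ (∼ x))

  ν-postfixed⇒central : ∀ {x} → x ≤ ν x → Central x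
  ν-postfixed⇒central {x} x≤νx = ∧∼≤⊥⇒central (begin
    x ∧ ∼ x            ≤⟨ ∧-monotonic (trans x≤νx (x∧y≤y _ _)) refl ⟩
    ¬ (∼ x) ∧ ∼ x      ≤⟨ ⇨-eval ⟩
    ⊥                  ∎)

  ↑ : ∀ {q} → (IC A → Set q) → Carrier → Set (c ⊔ ℓ₁ ⊔ ℓ₂ ⊔ q)
  ↑ G a = Σ (IC A) λ x → G x × proj₁ x ≤ a

  module _ {q} {F : Carrier → Set q} (F-involutive : IsInvolutiveFilter A F) where
    open IsInvolutiveFilter F-involutive
    open IsFilter isFilter

    fold-ν-∈ : ∀ {a} → F a → ∀ k → F (fold a ν k)
    fold-ν-∈ Fa zero    = Fa
    fold-ν-∈ Fa (suc k) = let Fx = fold-ν-∈ Fa k in meet Fx (involutive Fx)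

    finite⇒generated-by-IC : IsFinite A → ∀ {a} → F a → ↑ (F ∘ proj₁) a
    finite⇒generated-by-IC (_ , bij) {a} Fa
      with k , stable ← finite⇒deflationary-stabilises poset ν ν-deflationary bij a
      = (fold a ν k , ν-postfixed⇒central stable) , fold-ν-∈ Fa k
      , fold-antitone poset ν ν-deflationary a (z≤′n {k})

    finite⇒trace-⊆⇒⊆ : ∀ {r} {H : Carrier → Set r} → IsFinite A → IsFilter A H →
                       (∀ (x : IC A) → F (proj₁ x) → H (proj₁ x)) → ∀ {a} → F a → H a
    finite⇒trace-⊆⇒⊆ fin H-filter trace-⊆ Fa with x , Fx , x≤a ← finite⇒generated-by-IC fin Fa
      = IsFilter.upward H-filter x≤a (trace-⊆ x Fx)

    restrict-isICFilter : IsICFilter A (F ∘ proj₁)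
    restrict-isICFilter = record
      { nonempty = (⊤ , ⊤-central) , upward (maximum _) (proj₂ nonempty)
      ; upward   = upward
      ; meet     = λ z≈x∧y Fx Fy → upward (reflexive (E.sym z≈x∧y)) (meet Fx Fy)
      }

  upset-isInvolutiveFilter : ∀ {q} {G : IC A → Set q} → IsICFilter A G →
                             IsInvolutiveFilter A (↑ G)
  upset-isInvolutiveFilter G-filter = record
    { isFilter = record
      { nonempty = let (x , Gx) = nonempty in proj₁ x , x , Gx , refl
      ; upward   = λ { a≤b (x , Gx , x≤a) → x , Gx , trans x≤a a≤b }
      ; meet     = λ { (x , Gx , x≤a) (y , Gy , y≤b) →
                       (proj₁ x ∧ proj₁ y , ∧-central (proj₂ x) (proj₂ y))
                       , meet E.refl Gx Gy , ∧-monotonic x≤a y≤b }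
      }
    ; involutive = λ { (x , Gx , x≤a) → x , Gx , central-≤⇒≤¬∼ (proj₂ x) x≤a }
    }
    where open IsICFilter G-filter

  module _ (p : Level) where
    private
      module IF = Setoid (InvolutiveFilters A p)
      module ICF = Setoid (ICFilters A p)

    restrict : IF.Carrier → ICF.Carrier
    restrict (F , F-involutive) = F ∘ proj₁ , restrict-isICFilter F-involutive

    upset : ICF.Carrier → IF.Carrier
    upset (G , G-filter) = ↑ G , upset-isInvolutiveFilter G-filter

    restrict-cong : Congruent IF._≈_ ICF._≈_ restrict
    restrict-cong F≈F' x = F≈F' (proj₁ x)

    restrict-upset : ∀ G → restrict (upset G) ICF.≈ G
    restrict-upset (G , G-filter) x = mk⇔
      (λ { (y , Gy , y≤x) → IsICFilter.upward G-filter y≤x Gy })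
      (λ Gx → x , Gx , refl)

    restrict-surjective : Surjective IF._≈_ ICF._≈_ restrict
    restrict-surjective G = upset G , λ Z≈↑G x → ⇔-trans (Z≈↑G (proj₁ x)) (restrict-upset G x)

    finite⇒restrict-injective : IsFinite A → Injective IF._≈_ ICF._≈_ restrict
    finite⇒restrict-injective fin {F , F-inv} {F' , F'-inv} same-trace a = mk⇔
      (finite⇒trace-⊆⇒⊆ F-inv fin (isFilter F'-inv) λ x → Equivalence.to (same-trace x))
      (finite⇒trace-⊆⇒⊆ F'-inv fin (isFilter F-inv) λ x → Equivalence.from (same-trace x))
      where open IsInvolutiveFilter

theorem3p4 : {c ℓ₁ ℓ₂ p : Level} (A : HeytingAlgebraWithInvolution c ℓ₁ ℓ₂) →
    IsFinite A →
    Bijection (InvolutiveFilters A p) (ICFilters A p)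
theorem3p4 {p = p} A fin = record
  { to        = restrict A p
  ; cong      = λ {F} {F'} → restrict-cong A p {F} {F'}
  ; bijective = (λ {F} {F'} → finite⇒restrict-injective A p fin {F} {F'}) , restrict-surjective A p
  }
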